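{- Let $G=(V,E)$ be a graph with vertices ordered $v_0\prec v_1\prec\dots\prec v_n$, where $v_0$ is an isolated vertex, let $k\ge1$, and let $i\in\{0,\dots,n\}$. Let $\alpha\colon E_i\to[k]$ be a valid partial page assignment, let $v_a\prec v_i$ with $v_a\notin P^*_i$, and let $v_b\in P^*_i\cup\{v_i\}$ be such that $b>a$ and $b-a$ is minimum among all such vertices. Then $U_i(v_a,\alpha)=U_i(v_b,\alpha)$.
   Context: $[k]=\{1,\dots,k\}$. For each $i$, the guard set of $v_i$ is $P_i=\{v_j\mid j<i,\ \exists q\ge i \text{ with } v_jv_q\in E\}$, and $P^*_i=P_i\cup\{v_0\}$. Let $E_i=\{v_cv_d\in E\mid c<d,\ d>i\}$ be the set of edges with at least one endpoint to the right of $v_i$, and $S_i=\{v_cv_d\in E_i\mid c<d,\ v_c\in P^*_i\}$. An assignment $\alpha\colon E_i\to[k]$ is a valid partial page assignment if there are no two edges $v_av_b, v_cv_d\in E_i$ with $a<c<b<d$ and $\alpha(v_av_b)=\alpha(v_cv_d)$. For $a\le i$ and a page $p\in[k]$, the $(\alpha,i,p)$-important edge of $v_a$ is the edge $v_cv_d\in S_i$ ($c<d$) with $\alpha(v_cv_d)=p$ and $c<a$ for which $a-c$ is minimum, ties broken by minimum $d-c$; if it exists, its left endpoint $v_c$ is called the $(\alpha,i,p)$-important guard of $v_a$. The visibility vector $U_i(v_a,\alpha)$ is the vector indexed by $p\in[k]$ whose $p$-th component is the $(\alpha,i,p)$-important guard of $v_a$, or a special symbol $\diamond$ if $v_a$ has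 no $(\alpha,i,p)$-important edge. -}

module Defs where

open import Data.Nat using (ℕ; zero; suc; _+_; _∸_; _≤_; _<_; _>_; _≥_)
open import Data.Fin using (Fin)
open import Data.Maybe using (Maybe; just; nothing)
open import Data.Product using (Σ; ∃; ∃-syntax; _×_; _,_)
open import Data.Sum using (_⊎_)
open import Data.Empty using (⊥)
open import Relation.Nullary using (¬_)
open import Relation.Binary.PropositionalEquality using (_≡_)

-- A simple undirected graph on the ordered vertices v₀ ≺ v₁ ≺ … ≺ vₙ,
-- vertex vⱼ being represented by its index j (with j ≤ n).
record Graph (n : ℕ) : Set₁ where
  field
    Adj     : ℕ → ℕ → Set
    bounded : ∀ {c d} → Adj c d → c ≤ n × d ≤ n
    sym     : ∀ {c d} → Adj c d → Adj d c
    irrefl  : ∀ {c} → ¬ Adj c c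
open Graph public

module _ {n : ℕ} (G : Graph n) where

  Isolated₀ : Set
  Isolated₀ = ∀ d → ¬ Adj G 0 d

  P : ℕ → ℕ → Set
  P i j = j < i × ∃[ q ] (q ≥ i × Adj G j q)

  P* : ℕ → ℕ → Set
  P* i j = P i j ⊎ j ≡ 0

  InE : ℕ → ℕ → ℕ → Set
  InE i c d = c < d × d > i × Adj G c d

  InS : ℕ → ℕ → ℕ → Set
  InS i c d = InE i c d × P* i c

  module _ {k : ℕ} where

    -- A page assignment α : E_i → [k]; only its values on E_i matter.
    -- Pages [k] = {1,…,k} are represented by Fin k.
    Assignment : Set
    Assignment = ℕ → ℕ → Fin k

    ValidPartial : ℕ → Assignment → Set
    ValidPartial i α =
      ∀ a b c d → InE i a b → InE i c d →
        a < c → c < b → b < d → ¬ (α a b ≡ α c d)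

    Important : ℕ → Assignment → ℕ → Fin k → ℕ → ℕ → Set
    Important i α a p c d =
      InS i c d × α c d ≡ p × c < a ×
      (∀ c' d' → InS i c' d' → α c' d' ≡ p → c' < a →
         (a ∸ c < a ∸ c') ⊎ ((a ∸ c ≡ a ∸ c') × (d ∸ c ≤ d' ∸ c')))

    -- p-th component of the visibility vector U_i(v_a, α):
    -- just c  = the important guard v_c, nothing = the symbol ◇.
    VisComp : ℕ → Assignment → ℕ → Fin k → Maybe ℕ → Set
    VisComp i α a p (just c)  = ∃[ d ] Important i α a p c d
    VisComp i α a p nothing   = ¬ (∃[ c ] ∃[ d ] Important i α a p c d)

    -- U_i(v_a, α) = U_i(v_b, α): the two vectors have the same components
    -- (each component is uniquely determined by VisComp).
    SameVis : ℕ → Assignment → ℕ → ℕ → Set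
    SameVis i α a b =
      ∀ (p : Fin k) (g : Maybe ℕ) →
        (VisComp i α a p g → VisComp i α b p g) ×
        (VisComp i α b p g → VisComp i α a p g)

module Submission where

open import Defs
open import Data.Nat using (ℕ; _∸_; _≤_; _<_)
open import Data.Nat.Properties
  using (<⇒≤; <-trans; <⇒≱; ≮⇒≥; <-cmp; ∸-monoˡ-<; ∸-monoʳ-<; ∸-cancelʳ-<; ∸-cancelˡ-≡)
open import Data.Maybe using (just; nothing)
open import Data.Product using (_×_; _,_; proj₂)
open import Data.Sum using (_⊎_; inj₁; inj₂)
open import Data.Empty using (⊥-elim)
open import Relation.Nullary using (¬_)
open import Relation.Binary.Definitions using (tri<; tri≈; tri>)
open import Relation.Binary.PropositionalEquality using (_≡_; cong; subst)

-- The important edge of v_x only looks at the guards to the left of v_x and compares them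
-- by their order (a nearer guard is a larger one), which does not depend on x.  Since v_a
-- is not a guard and no guard lies strictly between v_a and v_b, the vertices v_a and v_b
-- see exactly the same guards to their left, hence the same important edges.

m∸o≤n∸o⇒m≤n : ∀ {m n o} → o ≤ n → m ∸ o ≤ n ∸ o → m ≤ n
m∸o≤n∸o⇒m≤n o≤n m∸o≤n∸o = ≮⇒≥ λ n<m → <⇒≱ (∸-monoˡ-< n<m o≤n) m∸o≤n∸o

Closer : ℕ → ℕ → ℕ → ℕ → ℕ → Set
Closer x c d c' d' = (x ∸ c < x ∸ c') ⊎ ((x ∸ c ≡ x ∸ c') × (d ∸ c ≤ d' ∸ c'))

closer-reanchor : ∀ {x y c d c' d'} → c ≤ x → c' ≤ x → c ≤ y →
  Closer x c d c' d' → Closer y c d c' d'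
closer-reanchor {x} {c' = c'} c≤x c'≤x c≤y (inj₁ nearer) =
  inj₁ (∸-monoʳ-< (∸-cancelʳ-< {n = c'} {o = x} nearer) c≤y)
closer-reanchor {y = y} c≤x c'≤x c≤y (inj₂ (tie , shorter)) =
  inj₂ (cong (y ∸_) (∸-cancelˡ-≡ c≤x c'≤x tie) , shorter)

module _ {n : ℕ} (G : Graph n) (i : ℕ) where

  GuardsBelow⊆ : ℕ → ℕ → Set
  GuardsBelow⊆ x y = ∀ c → P* G i c → c < x → c < y

  module _ {k : ℕ} (α : Assignment G {k}) where

    important-reanchor : ∀ {x y p c d} → GuardsBelow⊆ x y → GuardsBelow⊆ y x →
      Important G i α x p c d → Important G i α y p c d
    important-reanchor {y = y} {c = c} x⊆y y⊆x ((c∈E , c∈P*) , αcd≡p , c<x , nearest) =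
      (c∈E , c∈P*) , αcd≡p , c<y , λ c' d' c'd'∈S αc'd'≡p c'<y →
        let c'<x = y⊆x c' (proj₂ c'd'∈S) c'<y in
        closer-reanchor (<⇒≤ c<x) (<⇒≤ c'<x) (<⇒≤ c<y) (nearest c' d' c'd'∈S αc'd'≡p c'<x)
      where
      c<y : c < y
      c<y = x⊆y c c∈P* c<x

    visComp-reanchor : ∀ {x y} → GuardsBelow⊆ x y → GuardsBelow⊆ y x →
      ∀ p g → VisComp G i α x p g → VisComp G i α y p g
    visComp-reanchor x⊆y y⊆x p (just c) (d , imp) = d , important-reanchor x⊆y y⊆x imp
    visComp-reanchor x⊆y y⊆x p nothing none (c , d , imp) =
      none (c , d , important-reanchor y⊆x x⊆y imp)

    sameVis-of-guardsBelow : ∀ {x y} → GuardsBelow⊆ x y → GuardsBelow⊆ y x → SameVis G i α x y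
    sameVis-of-guardsBelow x⊆y y⊆x p g =
      visComp-reanchor x⊆y y⊆x p g , visComp-reanchor y⊆x x⊆y p g

  guardsBelow-mono : ∀ {x y} → x < y → GuardsBelow⊆ x y
  guardsBelow-mono x<y c _ c<x = <-trans c<x x<y

  guardsBelow-nearestAbove : ∀ {a b} → ¬ P* G i a → a < b →
    (∀ c → P* G i c → a < c → b ∸ a ≤ c ∸ a) → GuardsBelow⊆ b a
  guardsBelow-nearestAbove {a} a∉P* a<b nearest c c∈P* c<b with <-cmp c a
  ... | tri< c<a _ _ = c<a
  ... | tri≈ _ c≡a _ = ⊥-elim (a∉P* (subst (P* G i) c≡a c∈P*))
  ... | tri> _ _ a<c = ⊥-elim (<⇒≱ c<b (m∸o≤n∸o⇒m≤n (<⇒≤ a<c) (nearest c c∈P* a<c)))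

lemma3 : ∀ {n : ℕ} (G : Graph n) → Isolated₀ G →
    ∀ (k : ℕ) → 1 ≤ k →
    ∀ (i : ℕ) → i ≤ n →
    ∀ (α : Assignment G {k}) → ValidPartial G i α →
    ∀ (a : ℕ) → a < i → ¬ P* G i a →
    ∀ (b : ℕ) → (P* G i b ⊎ b ≡ i) → a < b →
    (∀ (b' : ℕ) → (P* G i b' ⊎ b' ≡ i) → a < b' → b ∸ a ≤ b' ∸ a) →
    SameVis G i α a b
lemma3 G _ k _ i _ α _ a _ a∉P* b _ a<b b-nearest =
  sameVis-of-guardsBelow G i α
    (guardsBelow-mono G i a<b)
    (guardsBelow-nearestAbove G i a∉P* a<b λ c c∈P* → b-nearest c (inj₁ c∈P*))
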